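{- Let $m,n\ge1$ and let $(u_{i,j})$ be a positive integral $(m,n)$-periodic $SL_2$-tiling. Then $\frac{u_{i+m,j}+u_{i,j+n}}{u_{i,j}}$ is an integer independent of $i,j\in\mathbb Z$. Moreover, it equals the growth of each of the two infinite frieze patterns $(v_{k,l})$ and $(w_{k,l})$ determined by $v_{k-1,k+1}=\frac{u_{k-1,j_0}+u_{k+1,j_0}}{u_{k,j_0}}$ and $w_{k-1,k+1}=\frac{u_{i_0,k-1}+u_{i_0,k+1}}{u_{i_0,k}}$ (for any fixed $i_0,j_0$), i.e. it equals $v_{k,k+m+1}-v_{k+1,k+m}$ and $w_{k,k+n+1}-w_{k+1,k+n}$ for all $k$.
   Context: An $SL_2$-tiling is a family $(u_{i,j})_{i,j\in\mathbb Z}$ of reals with $u_{i+1,j}u_{i,j+1}-u_{i,j}u_{i+1,j+1}=1$ for all $i,j$; positive integral if all entries are positive integers; $(m,n)$-periodic if $u_{i+m,j+n}=u_{i,j}$ for all $i,j$. An infinite frieze pattern is a family $(v_{k,l})_{k,l\in\mathbb Z,\ l\ge k}$ with $v_{k,k}=0$, $v_{k,k+1}=1$ and $v_{k,l}v_{k+1,l+1}-v_{k,l+1}v_{k+1,l}=1$ whenever defined; it is uniquely determined by its quiddity sequence $(v_{k,k+2})_k$. For a $p$-periodic infinite frieze pattern ($v_{k+p,l+p}=v_{k,l}$), its growth is the value $v_{k,k+p+1}-v_{k+1,k+p}$, which is independent of $k$. -}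

module Defs where

open import Data.Nat using (ℕ)
open import Data.Integer using (ℤ; +_; _+_; _-_; _*_; _<_; 0ℤ; 1ℤ)
open import Data.Product using (_×_)
open import Relation.Binary.PropositionalEquality using (_≡_)

IsSL2Tiling : (ℤ → ℤ → ℤ) → Set
IsSL2Tiling u = ∀ i j →
  u (i + 1ℤ) j * u i (j + 1ℤ) - u i j * u (i + 1ℤ) (j + 1ℤ) ≡ 1ℤ

IsPositive : (ℤ → ℤ → ℤ) → Set
IsPositive u = ∀ i j → 0ℤ < u i j

IsPeriodic : ℕ → ℕ → (ℤ → ℤ → ℤ) → Set
IsPeriodic m n u = ∀ i j → u (i + + m) (j + + n) ≡ u i j

-- An infinite frieze pattern v_{k,l} (l ≥ k), represented as a total function
-- ℤ → ℤ → ℤ whose values at l < k are irrelevant.  The unimodular rule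
-- v(k,l) v(k+1,l+1) - v(k,l+1) v(k+1,l) = 1 is imposed whenever all four
-- entries are defined, i.e. for k < l.
IsInfiniteFrieze : (ℤ → ℤ → ℤ) → Set
IsInfiniteFrieze v =
  (∀ k → v k k ≡ 0ℤ) ×
  (∀ k → v k (k + 1ℤ) ≡ 1ℤ) ×
  (∀ k l → k < l →
     v k l * v (k + 1ℤ) (l + 1ℤ) - v k (l + 1ℤ) * v (k + 1ℤ) l ≡ 1ℤ)

{-# OPTIONS --safe #-}
-- Two adjacent columns x, y of an SL₂-tiling have unit Wronskian, so by the Plücker relation
-- their 2×2 minors Δ(k,l) = x_l y_k − x_k y_l form an infinite frieze pattern whose quiddity is
-- (x_{k−1} + x_{k+1}) / x_k; when x > 0 the minors are positive, which forces every frieze with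
-- that quiddity to coincide with Δ. Adjacent rows have the same quiddities, so all rows obey one
-- linear recurrence and Δ does not depend on the column; with periodicity, Δ is invariant under
-- (k,l) ↦ (k+m,l+m). Expanding x_{i±m} in the basis x_i, x_{i+1} then gives
-- x_{i+m} + x_{i−m} = g(i) x_i with g(i) the growth of Δ, and x_{i−m} = u(i,j+n). Doing the same
-- with rows gives h(j) u(i,j) for the same sum, so g(i) = h(j) is a constant.
module Submission where

open import Defs
open import Data.Nat using (ℕ; _≥_; zero; suc; z<s)
import Data.Nat.Properties as ℕ
open import Data.Integer
  using (ℤ; +_; -[1+_]; _+_; _-_; _*_; 0ℤ; 1ℤ; _<_; +<+; >-nonZero; nonNegative)
open import Data.Integer.Properties
  using ( +-comm; +-identityʳ; +-monoʳ-<; *-comm; *-identityʳ; *-cancelʳ-≡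
        ; *-cancelʳ-<-nonNeg; <⇒≤)
open import Data.Integer.Tactic.RingSolver using (solve-∀)
open import Data.Product using (Σ; _×_; _,_; proj₁; proj₂)
open import Function using (flip)
open import Relation.Binary.PropositionalEquality
  using (_≡_; refl; sym; trans; cong; cong₂; subst; module ≡-Reasoning)

-- `+ suc n` is definitionally `1ℤ + + n`, which lets the ring solver treat `+ n` as a variable.
i+[1+n]≡i+n+1 : ∀ i n → i + + suc n ≡ i + + n + 1ℤ
i+[1+n]≡i+n+1 i n = ring i (+ n)
  where
  ring : ∀ i j → i + (1ℤ + j) ≡ i + j + 1ℤ
  ring = solve-∀

i+1+n≡i+[1+n] : ∀ i n → i + 1ℤ + + n ≡ i + + suc n
i+1+n≡i+[1+n] i n = ring i (+ n)
  where
  ring : ∀ i j → i + 1ℤ + j ≡ i + (1ℤ + j)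
  ring = solve-∀

i+1+j≡i+j+1 : ∀ i j → i + 1ℤ + j ≡ i + j + 1ℤ
i+1+j≡i+j+1 = solve-∀

i-j+j≡i : ∀ i j → i - j + j ≡ i
i-j+j≡i = solve-∀

i+1-1≡i : ∀ i → i + 1ℤ - 1ℤ ≡ i
i+1-1≡i = solve-∀

i<i+[1+n] : ∀ i n → i < i + + suc n
i<i+[1+n] i n = subst (_< i + + suc n) (+-identityʳ i) (+-monoʳ-< i (+<+ z<s))

a≡b+c⇒c≡a-b : ∀ {a b c} → a ≡ b + c → c ≡ a - b
a≡b+c⇒c≡a-b {b = b} {c} eq = trans (ring b c) (cong (_- b) (sym eq))
  where
  ring : ∀ b c → c ≡ b + c - b
  ring = solve-∀

a-b≡1⇒b≡a-1 : ∀ {a b} → a - b ≡ 1ℤ → b ≡ a - 1ℤ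
a-b≡1⇒b≡a-1 {a} {b} eq = trans (ring a b) (cong (a -_) eq)
  where
  ring : ∀ a b → b ≡ a - (a - b)
  ring = solve-∀

0<a+b*c : ∀ {a b c} → 0ℤ < a → 0ℤ < b → 0ℤ < c → 0ℤ < a + b * c
0<a+b*c {+ suc _} {+ suc _} {+ suc _} _ _ _ = +<+ z<s
0<a+b*c {+ zero} (+<+ ()) _ _
0<a+b*c {b = + zero} _ (+<+ ()) _
0<a+b*c {c = + zero} _ _ (+<+ ())

0<a*b⇒0<a : ∀ {a b} → 0ℤ < a * b → 0ℤ < b → 0ℤ < a
0<a*b⇒0<a {b = b} 0<ab 0<b = *-cancelʳ-<-nonNeg b {{nonNegative (<⇒≤ 0<b)}} 0<ab

translation-invariant⇒constant : ∀ {a} {A : Set a} (f : ℤ → A) →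
  (∀ i → f (i + 1ℤ) ≡ f i) → ∀ i j → f i ≡ f j
translation-invariant⇒constant f invariant i j = trans (to-origin i) (sym (to-origin j))
  where
  to-origin : ∀ i → f i ≡ f 0ℤ
  to-origin (+ zero)     = refl
  to-origin (+ suc n)    =
    trans (cong (λ n → f (+ n)) (ℕ.+-comm 1 n)) (trans (invariant (+ n)) (to-origin (+ n)))
  to-origin -[1+ zero ]  = sym (invariant -[1+ 0 ])
  to-origin -[1+ suc n ] = trans (sym (invariant -[1+ suc n ])) (to-origin -[1+ n ])

minor : (ℤ → ℤ) → (ℤ → ℤ) → ℤ → ℤ → ℤ
minor x y k l = x l * y k - x k * y l

minor-diagonal : ∀ x y k → minor x y k k ≡ 0ℤ
minor-diagonal x y k = ring (x k) (y k)
  where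
  ring : ∀ a b → a * b - a * b ≡ 0ℤ
  ring = solve-∀

minor-three-termˣ : ∀ x y k l l′ →
  minor x y k l′ * x l ≡ x k * minor x y l l′ + x l′ * minor x y k l
minor-three-termˣ x y k l l′ = ring (x k) (x l) (x l′) (y k) (y l) (y l′)
  where
  ring : ∀ a b c a′ b′ c′ →
    (c * a′ - a * c′) * b ≡ a * (c * b′ - b * c′) + c * (b * a′ - a * b′)
  ring = solve-∀

minor-three-termʸ : ∀ x y k l l′ →
  minor x y k l′ * y l ≡ y k * minor x y l l′ + y l′ * minor x y k l
minor-three-termʸ x y k l l′ = ring (x k) (x l) (x l′) (y k) (y l) (y l′)
  where
  ring : ∀ a b c a′ b′ c′ →
    (c * a′ - a * c′) * b′ ≡ a′ * (c * b′ - b * c′) + c′ * (b * a′ - a * b′)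
  ring = solve-∀

minor-plücker : ∀ x y k k′ l l′ →
  minor x y k l * minor x y k′ l′ - minor x y k l′ * minor x y k′ l
    ≡ minor x y k k′ * minor x y l l′
minor-plücker x y k k′ l l′ =
  ring (x k) (x k′) (x l) (x l′) (y k) (y k′) (y l) (y l′)
  where
  ring : ∀ a a′ b b′ c c′ d d′ →
    (b * c - a * d) * (b′ * c′ - a′ * d′) - (b′ * c - a * d′) * (b * c′ - a′ * d)
      ≡ (a′ * c - a * c′) * (b′ * d - b * d′)
  ring = solve-∀

minor-recurrence : ∀ x y z b → (∀ r → z r ≡ b * y r - x r) →
  ∀ k l → minor y z k l ≡ minor x y k l
minor-recurrence x y z b recurrence k l = begin
  y l * z k - y k * z l
    ≡⟨ cong₂ (λ zk zl → y l * zk - y k * zl) (recurrence k) (recurrence l) ⟩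
  y l * (b * y k - x k) - y k * (b * y l - x l)
    ≡⟨ ring b (x k) (x l) (y k) (y l) ⟩
  x l * y k - x k * y l ∎
  where
  open ≡-Reasoning
  ring : ∀ b a a′ c c′ → c′ * (b * c - a) - c * (b * c′ - a′) ≡ a′ * c - a * c′
  ring = solve-∀

module UnimodularPair (x y : ℤ → ℤ) (minor-adjacent : ∀ k → minor x y k (k + 1ℤ) ≡ 1ℤ) where

  Δ : ℤ → ℤ → ℤ
  Δ = minor x y

  growth : ℕ → ℤ → ℤ
  growth p k = Δ k (k + + p + 1ℤ) - Δ (k + 1ℤ) (k + + p)

  Δ-unimodular : ∀ k l → Δ k l * Δ (k + 1ℤ) (l + 1ℤ) - Δ k (l + 1ℤ) * Δ (k + 1ℤ) l ≡ 1ℤ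
  Δ-unimodular k l = trans (minor-plücker x y k (k + 1ℤ) l (l + 1ℤ))
                           (cong₂ _*_ (minor-adjacent k) (minor-adjacent l))

  expansionˣ : ∀ k l → Δ k l * x (k + 1ℤ) ≡ x k * Δ (k + 1ℤ) l + x l
  expansionˣ k l = begin
    Δ k l * x (k + 1ℤ)
      ≡⟨ minor-three-termˣ x y k (k + 1ℤ) l ⟩
    x k * Δ (k + 1ℤ) l + x l * Δ k (k + 1ℤ)
      ≡⟨ cong (λ d → x k * Δ (k + 1ℤ) l + x l * d) (minor-adjacent k) ⟩
    x k * Δ (k + 1ℤ) l + x l * 1ℤ
      ≡⟨ cong (_+_ (x k * Δ (k + 1ℤ) l)) (*-identityʳ (x l)) ⟩
    x k * Δ (k + 1ℤ) l + x l ∎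
    where open ≡-Reasoning

  Δ-stepˣ : ∀ k l → Δ k (l + 1ℤ) * x l ≡ x k + x (l + 1ℤ) * Δ k l
  Δ-stepˣ k l = begin
    Δ k (l + 1ℤ) * x l
      ≡⟨ minor-three-termˣ x y k l (l + 1ℤ) ⟩
    x k * Δ l (l + 1ℤ) + x (l + 1ℤ) * Δ k l
      ≡⟨ cong (λ d → x k * d + x (l + 1ℤ) * Δ k l) (minor-adjacent l) ⟩
    x k * 1ℤ + x (l + 1ℤ) * Δ k l
      ≡⟨ cong (_+ x (l + 1ℤ) * Δ k l) (*-identityʳ (x k)) ⟩
    x k + x (l + 1ℤ) * Δ k l ∎
    where open ≡-Reasoning

  quiddityˣ : ∀ k → Δ k (k + 1ℤ + 1ℤ) * x (k + 1ℤ) ≡ x k + x (k + 1ℤ + 1ℤ)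
  quiddityˣ k = begin
    Δ k (k + 1ℤ + 1ℤ) * x (k + 1ℤ)
      ≡⟨ Δ-stepˣ k (k + 1ℤ) ⟩
    x k + x (k + 1ℤ + 1ℤ) * Δ k (k + 1ℤ)
      ≡⟨ cong (λ d → x k + x (k + 1ℤ + 1ℤ) * d) (minor-adjacent k) ⟩
    x k + x (k + 1ℤ + 1ℤ) * 1ℤ
      ≡⟨ cong (_+_ (x k)) (*-identityʳ (x (k + 1ℤ + 1ℤ))) ⟩
    x k + x (k + 1ℤ + 1ℤ) ∎
    where open ≡-Reasoning

  quiddityʸ : ∀ k → Δ k (k + 1ℤ + 1ℤ) * y (k + 1ℤ) ≡ y k + y (k + 1ℤ + 1ℤ)
  quiddityʸ k = begin
    Δ k (k + 1ℤ + 1ℤ) * y (k + 1ℤ)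
      ≡⟨ minor-three-termʸ x y k (k + 1ℤ) (k + 1ℤ + 1ℤ) ⟩
    y k * Δ (k + 1ℤ) (k + 1ℤ + 1ℤ) + y (k + 1ℤ + 1ℤ) * Δ k (k + 1ℤ)
      ≡⟨ cong₂ (λ d e → y k * d + y (k + 1ℤ + 1ℤ) * e) (minor-adjacent (k + 1ℤ)) (minor-adjacent k) ⟩
    y k * 1ℤ + y (k + 1ℤ + 1ℤ) * 1ℤ
      ≡⟨ cong₂ _+_ (*-identityʳ (y k)) (*-identityʳ (y (k + 1ℤ + 1ℤ))) ⟩
    y k + y (k + 1ℤ + 1ℤ) ∎
    where open ≡-Reasoning

  shift-sum : ∀ p → (∀ k l → Δ (k + + p) (l + + p) ≡ Δ k l) →
    ∀ i → x (i + + p) + x (i - + p) ≡ growth p i * x i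
  shift-sum p periodic i = begin
    x (i + + p) + x (i - + p)
      ≡⟨ cong₂ _+_ (a≡b+c⇒c≡a-b (expansionˣ i (i + + p)))
                   (a≡b+c⇒c≡a-b (trans (Δ-stepˣ (i - + p) i) (+-comm (x (i - + p)) _))) ⟩
    (Δ i (i + + p) * x (i + 1ℤ) - x i * Δ (i + 1ℤ) (i + + p))
      + (Δ (i - + p) (i + 1ℤ) * x i - x (i + 1ℤ) * Δ (i - + p) i)
      ≡⟨ cong₂ (λ d e → (Δ i (i + + p) * x (i + 1ℤ) - x i * Δ (i + 1ℤ) (i + + p))
                          + (d * x i - x (i + 1ℤ) * e))
               Δ[i-p,i+1] Δ[i-p,i] ⟩
    (Δ i (i + + p) * x (i + 1ℤ) - x i * Δ (i + 1ℤ) (i + + p))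
      + (Δ i (i + + p + 1ℤ) * x i - x (i + 1ℤ) * Δ i (i + + p))
      ≡⟨ ring (Δ i (i + + p)) (Δ (i + 1ℤ) (i + + p)) (Δ i (i + + p + 1ℤ)) (x i) (x (i + 1ℤ)) ⟩
    growth p i * x i ∎
    where
    open ≡-Reasoning
    ring : ∀ a b c x₀ x₁ → (a * x₁ - x₀ * b) + (c * x₀ - x₁ * a) ≡ (c - b) * x₀
    ring = solve-∀
    Δ[i-p,i+1] : Δ (i - + p) (i + 1ℤ) ≡ Δ i (i + + p + 1ℤ)
    Δ[i-p,i+1] = sym (trans (cong₂ Δ (sym (i-j+j≡i i (+ p))) (sym (i+1+j≡i+j+1 i (+ p))))
                            (periodic (i - + p) (i + 1ℤ)))
    Δ[i-p,i] : Δ (i - + p) i ≡ Δ i (i + + p)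
    Δ[i-p,i] = sym (trans (cong (λ k → Δ k (i + + p)) (sym (i-j+j≡i i (+ p))))
                          (periodic (i - + p) i))

  module Positive (positive : ∀ k → 0ℤ < x k) where

    Δ-positive : ∀ k d → 0ℤ < Δ k (k + + suc d)
    Δ-positive k zero    = subst (0ℤ <_) (sym (minor-adjacent k)) (+<+ z<s)
    Δ-positive k (suc d) rewrite i+[1+n]≡i+n+1 k (suc d) =
      0<a*b⇒0<a
        (subst (0ℤ <_) (sym (Δ-stepˣ k l))
               (0<a+b*c (positive k) (positive (l + 1ℤ)) (Δ-positive k d)))
        (positive l)
      where
      l : ℤ
      l = k + + suc d

    module Frieze (v : ℤ → ℤ → ℤ) (frieze : IsInfiniteFrieze v)
      (quiddity : ∀ k → v (k - 1ℤ) (k + 1ℤ) * x k ≡ x (k - 1ℤ) + x (k + 1ℤ)) where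

      private
        v-diagonal : ∀ k → v k k ≡ 0ℤ
        v-diagonal = proj₁ frieze
        v-adjacent : ∀ k → v k (k + 1ℤ) ≡ 1ℤ
        v-adjacent = proj₁ (proj₂ frieze)
        v-unimodular : ∀ k l → k < l → v k l * v (k + 1ℤ) (l + 1ℤ) - v k (l + 1ℤ) * v (k + 1ℤ) l ≡ 1ℤ
        v-unimodular = proj₂ (proj₂ frieze)

      Agrees : ℤ → ℤ → Set
      Agrees k l = v k l ≡ Δ k l

      frieze≡Δ-step : ∀ {k l} → k < l → 0ℤ < Δ (k + 1ℤ) l →
        Agrees k l → Agrees (k + 1ℤ) l → Agrees (k + 1ℤ) (l + 1ℤ) → Agrees k (l + 1ℤ)
      frieze≡Δ-step {k} {l} k<l 0<Δ v≡Δ₀₀ v≡Δ₁₀ v≡Δ₁₁ =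
        *-cancelʳ-≡ _ _ (Δ (k + 1ℤ) l) {{>-nonZero 0<Δ}} (begin
          v k (l + 1ℤ) * Δ (k + 1ℤ) l
            ≡⟨ cong (v k (l + 1ℤ) *_) (sym v≡Δ₁₀) ⟩
          v k (l + 1ℤ) * v (k + 1ℤ) l
            ≡⟨ a-b≡1⇒b≡a-1 {a = v k l * v (k + 1ℤ) (l + 1ℤ)} (v-unimodular k l k<l) ⟩
          v k l * v (k + 1ℤ) (l + 1ℤ) - 1ℤ
            ≡⟨ cong₂ (λ a b → a * b - 1ℤ) v≡Δ₀₀ v≡Δ₁₁ ⟩
          Δ k l * Δ (k + 1ℤ) (l + 1ℤ) - 1ℤ
            ≡⟨ sym (a-b≡1⇒b≡a-1 {a = Δ k l * Δ (k + 1ℤ) (l + 1ℤ)} (Δ-unimodular k l)) ⟩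
          Δ k (l + 1ℤ) * Δ (k + 1ℤ) l ∎)
        where open ≡-Reasoning

      frieze≡Δ : ∀ d k → Agrees k (k + + d)
      frieze≡Δ zero k rewrite +-identityʳ k = trans (v-diagonal k) (sym (minor-diagonal x y k))
      frieze≡Δ (suc zero) k = trans (v-adjacent k) (sym (minor-adjacent k))
      frieze≡Δ (suc (suc zero)) k rewrite i+[1+n]≡i+n+1 k 1 =
        *-cancelʳ-≡ _ _ (x (k + 1ℤ)) {{>-nonZero (positive (k + 1ℤ))}}
          (trans (subst (λ j → v j (k + 1ℤ + 1ℤ) * x (k + 1ℤ) ≡ x j + x (k + 1ℤ + 1ℤ))
                        (i+1-1≡i k) (quiddity (k + 1ℤ)))
                 (sym (quiddityˣ k)))
      frieze≡Δ (suc (suc (suc d))) k =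
        subst (Agrees k) (sym (i+[1+n]≡i+n+1 k (suc (suc d))))
          (frieze≡Δ-step (i<i+[1+n] k (suc d))
            (subst (λ l → 0ℤ < Δ (k + 1ℤ) l) k+1+[1+d] (Δ-positive (k + 1ℤ) d))
            (frieze≡Δ (suc (suc d)) k)
            (subst (Agrees (k + 1ℤ)) k+1+[1+d] (frieze≡Δ (suc d) (k + 1ℤ)))
            (subst (Agrees (k + 1ℤ)) k+1+[2+d] (frieze≡Δ (suc (suc d)) (k + 1ℤ))))
        where
        k+1+[1+d] : k + 1ℤ + + suc d ≡ k + + suc (suc d)
        k+1+[1+d] = i+1+n≡i+[1+n] k (suc d)
        k+1+[2+d] : k + 1ℤ + + suc (suc d) ≡ k + + suc (suc d) + 1ℤ
        k+1+[2+d] = trans (i+1+n≡i+[1+n] k (suc (suc d))) (i+[1+n]≡i+n+1 k (suc (suc d)))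

      frieze-growth : ∀ p → p ≥ 1 → ∀ k → v k (k + + p + 1ℤ) - v (k + 1ℤ) (k + + p) ≡ growth p k
      frieze-growth (suc p) _ k = cong₂ _-_
        (subst (Agrees k) (i+[1+n]≡i+n+1 k (suc p)) (frieze≡Δ (suc (suc p)) k))
        (subst (Agrees (k + 1ℤ)) (i+1+n≡i+[1+n] k p) (frieze≡Δ p (k + 1ℤ)))

column : (ℤ → ℤ → ℤ) → ℤ → ℤ → ℤ
column u j i = u i j

transpose-isSL2Tiling : ∀ {u} → IsSL2Tiling u → IsSL2Tiling (flip u)
transpose-isSL2Tiling {u} tiling i j =
  trans (cong (_- u j i * u (j + 1ℤ) (i + 1ℤ)) (*-comm (u j (i + 1ℤ)) (u (j + 1ℤ) i))) (tiling j i)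

module PositiveTiling (u : ℤ → ℤ → ℤ) (tiling : IsSL2Tiling u) (positive : IsPositive u) where

  module Column (j : ℤ) = UnimodularPair (column u j) (column u (j + 1ℤ)) (λ i → tiling i j)

  quiddity-shift-invariant : ∀ i j → Column.Δ (j + 1ℤ) i (i + 1ℤ + 1ℤ) ≡ Column.Δ j i (i + 1ℤ + 1ℤ)
  quiddity-shift-invariant i j =
    *-cancelʳ-≡ _ _ (u (i + 1ℤ) (j + 1ℤ)) {{>-nonZero (positive _ _)}}
      (trans (Column.quiddityˣ (j + 1ℤ) i) (sym (Column.quiddityʸ j i)))

  column-recurrence : ∀ i j → u (i + 1ℤ + 1ℤ) j ≡ Column.Δ 0ℤ i (i + 1ℤ + 1ℤ) * u (i + 1ℤ) j - u i j
  column-recurrence i j = a≡b+c⇒c≡a-b (begin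
    Column.Δ 0ℤ i (i + 1ℤ + 1ℤ) * u (i + 1ℤ) j
      ≡⟨ cong (_* u (i + 1ℤ) j) quiddity-constant ⟩
    Column.Δ j i (i + 1ℤ + 1ℤ) * u (i + 1ℤ) j
      ≡⟨ Column.quiddityˣ j i ⟩
    u i j + u (i + 1ℤ + 1ℤ) j ∎)
    where
    open ≡-Reasoning
    quiddity-constant : Column.Δ 0ℤ i (i + 1ℤ + 1ℤ) ≡ Column.Δ j i (i + 1ℤ + 1ℤ)
    quiddity-constant =
      translation-invariant⇒constant (λ j → Column.Δ j i (i + 1ℤ + 1ℤ))
        (quiddity-shift-invariant i) 0ℤ j

module PeriodicTiling (m n : ℕ) (u : ℤ → ℤ → ℤ)
  (tiling : IsSL2Tiling u) (positive : IsPositive u) (periodic : IsPeriodic m n u) where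

  open PositiveTiling u tiling positive
  private
    module Transposed =
      PositiveTiling (flip u) (transpose-isSL2Tiling {u} tiling) (λ i j → positive j i)

  row-recurrence : ∀ i j →
    u i (j + 1ℤ + 1ℤ) ≡ Transposed.Column.Δ 0ℤ j (j + 1ℤ + 1ℤ) * u i (j + 1ℤ) - u i j
  row-recurrence i j = Transposed.column-recurrence j i

  Δ-shift-invariant : ∀ j k l → Column.Δ (j + 1ℤ) k l ≡ Column.Δ j k l
  Δ-shift-invariant j =
    minor-recurrence (column u j) (column u (j + 1ℤ)) (column u (j + 1ℤ + 1ℤ))
      (Transposed.Column.Δ 0ℤ j (j + 1ℤ + 1ℤ)) (λ r → row-recurrence r j)

  Δ-independent : ∀ j j′ k l → Column.Δ j k l ≡ Column.Δ j′ k l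
  Δ-independent j j′ k l =
    translation-invariant⇒constant (λ j → Column.Δ j k l) (λ j → Δ-shift-invariant j k l) j j′

  Δ-periodic : ∀ j k l → Column.Δ j (k + + m) (l + + m) ≡ Column.Δ j k l
  Δ-periodic j k l = trans (Δ-independent j (j + + n) _ _)
    (cong₂ _-_ (cong₂ _*_ (periodic l j) (periodic-next k))
               (cong₂ _*_ (periodic k j) (periodic-next l)))
    where
    periodic-next : ∀ i → u (i + + m) (j + + n + 1ℤ) ≡ u i (j + 1ℤ)
    periodic-next i = trans (cong (u (i + + m)) (sym (i+1+j≡i+j+1 j (+ n)))) (periodic i (j + 1ℤ))

  columnGrowth : ℤ → ℤ
  columnGrowth = Column.growth 0ℤ m

  growth-independent : ∀ j k → Column.growth j m k ≡ columnGrowth k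
  growth-independent j k = cong₂ _-_ (Δ-independent j 0ℤ _ _) (Δ-independent j 0ℤ _ _)

  shift-sum : ∀ i j → u (i + + m) j + u i (j + + n) ≡ columnGrowth i * u i j
  shift-sum i j = begin
    u (i + + m) j + u i (j + + n)
      ≡⟨ cong (_+_ (u (i + + m) j)) periodic-back ⟩
    u (i + + m) j + u (i - + m) j
      ≡⟨ Column.shift-sum j m (Δ-periodic j) i ⟩
    Column.growth j m i * u i j
      ≡⟨ cong (_* u i j) (growth-independent j i) ⟩
    columnGrowth i * u i j ∎
    where
    open ≡-Reasoning
    periodic-back : u i (j + + n) ≡ u (i - + m) j
    periodic-back =
      trans (cong (λ r → u r (j + + n)) (sym (i-j+j≡i i (+ m)))) (periodic (i - + m) j)

  frieze-growth : m ≥ 1 → ∀ (j₀ : ℤ) (v : ℤ → ℤ → ℤ) → IsInfiniteFrieze v →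
    (∀ k → v (k - 1ℤ) (k + 1ℤ) * u k j₀ ≡ u (k - 1ℤ) j₀ + u (k + 1ℤ) j₀) →
    ∀ k → v k (k + + m + 1ℤ) - v (k + 1ℤ) (k + + m) ≡ columnGrowth k
  frieze-growth m≥1 j₀ v frieze quiddity k =
    trans (Column.Positive.Frieze.frieze-growth j₀ (λ i → positive i j₀) v frieze quiddity
             m m≥1 k)
          (growth-independent j₀ k)

proposition6p6 : (m n : ℕ) → m ≥ 1 → n ≥ 1 → (u : ℤ → ℤ → ℤ) →
    IsSL2Tiling u → IsPositive u → IsPeriodic m n u →
    Σ ℤ (λ c →
      (∀ i j → u (i + + m) j + u i (j + + n) ≡ c * u i j) ×
      (∀ (j₀ : ℤ) (v : ℤ → ℤ → ℤ) → IsInfiniteFrieze v →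
        (∀ k → v (k - 1ℤ) (k + 1ℤ) * u k j₀ ≡ u (k - 1ℤ) j₀ + u (k + 1ℤ) j₀) →
        ∀ k → v k (k + + m + 1ℤ) - v (k + 1ℤ) (k + + m) ≡ c) ×
      (∀ (i₀ : ℤ) (w : ℤ → ℤ → ℤ) → IsInfiniteFrieze w →
        (∀ k → w (k - 1ℤ) (k + 1ℤ) * u i₀ k ≡ u i₀ (k - 1ℤ) + u i₀ (k + 1ℤ)) →
        ∀ k → w k (k + + n + 1ℤ) - w (k + 1ℤ) (k + + n) ≡ c))
proposition6p6 m n m≥1 n≥1 u tiling positive periodic =
  c , (λ i j → trans (Columns.shift-sum i j) (cong (_* u i j) (column≡c i)))
    , (λ j₀ v frieze quiddity k →
         trans (Columns.frieze-growth m≥1 j₀ v frieze quiddity k) (column≡c k))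
    , (λ i₀ w frieze quiddity k →
         trans (Rows.frieze-growth n≥1 i₀ w frieze quiddity k) (sym (column≡row 0ℤ k)))
  where
  module Columns = PeriodicTiling m n u tiling positive periodic
  module Rows = PeriodicTiling n m (flip u) (transpose-isSL2Tiling {u} tiling)
                  (λ i j → positive j i) (λ i j → periodic j i)

  column≡row : ∀ i j → Columns.columnGrowth i ≡ Rows.columnGrowth j
  column≡row i j = *-cancelʳ-≡ _ _ (u i j) {{>-nonZero (positive i j)}}
    (trans (sym (Columns.shift-sum i j)) (trans (+-comm (u (i + + m) j) _) (Rows.shift-sum j i)))

  c : ℤ
  c = Columns.columnGrowth 0ℤ

  column≡c : ∀ i → Columns.columnGrowth i ≡ c
  column≡c i = trans (column≡row i 0ℤ) (sym (column≡row 0ℤ 0ℤ))
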